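{- Let $(G,\mathcal{B},\mathcal{L},\mathcal{F})$ be a quasi-biased graph such that $G$ is connected and $M=M(G,\mathcal{B},\mathcal{L},\mathcal{F})$ is disconnected, loopless, and of rank two; let $X$ and $Y$ be the two parallel classes of $M$. Then one of the following holds: (i) $|V(G)|=3$, $G$ is loopless, all cycles are balanced, and $X$ and $Y$ are the sets of edges joining two different pairs of vertices; (ii) $|V(G)|=2$, $G$ is loopless, and a cycle is balanced if and only if it is contained in $X$ or contained in $Y$; (iii) $|V(G)|=2$, $X$ consists of unbalanced loops at a common vertex, and $Y$ consists of all edges between the two vertices of $G$; (iv) $|V(G)|=2$, $G$ has loops at both vertices, all loops are in $\mathcal{L}$, $X$ is the set of loops, and $Y$ is the set of non-loops.
   Context: Graphs are finite with loops and parallel edges allowed; cycles include loops and 2-cycles. A quasi-biased graph $(G,\mathcal{B},\mathcal{L},\mathcal{F})$ is a graph with a partition $(\mathcal{B},\mathcal{L},\mathcal{F})$ of its cycles such that no theta subgraph contains exactly two cycles of $\mathcal{B}$ and every cycle in $\mathcal{L}$ shares a vertex with every cycle in $\mathcal{F}$. Cycles in $\mathcal{B}$ are balanced, others unbalanced. $M(G,\mathcal{B},\mathcal{L},\mathcal{F})$ is the matroid on $E(G)$ with circuits: cycles in $\mathcal{B}$; theta subgraphs with no cycle in $\mathcal{B}$; tight handcuffs (two edge-disjoint cycles sharing exactly one vertex) with neither cycle in $\mathcal{B}$; unions of two vertex-disjoint cycles of $\mathcal{L}$; loose handcuffs (two vertex-disjoint cycles plus a minimal path joining them) with both cycles in $\mathcal{F}$.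 -}

module Defs where

open import Data.Nat using (ℕ; zero; suc; _+_; _≤_; _<_)
open import Data.Fin using (Fin)
open import Data.Fin.Properties using (_≟_)
open import Data.Fin.Subset using (Subset; _∈_; _∉_; _⊆_; _∪_; ∣_∣; ⁅_⁆; ⊤; Nonempty)
open import Data.List using (List; map; allFin)
open import Data.Nat.ListAction using (sum)
open import Data.Product using (Σ; ∃; ∃-syntax; _×_; _,_; proj₁; proj₂)
open import Data.Sum using (_⊎_)
open import Relation.Nullary using (¬_; does)
open import Relation.Binary.PropositionalEquality using (_≡_; _≢_)
open import Function.Bundles using (_⇔_)
open import Data.Bool using (if_then_else_)

-- Finite graphs with loops and parallel edges allowed.
-- Vertices are Fin n, edges are Fin m; each edge has two ends
-- (a loop has both ends equal).  Subgraphs are identified with edge sets.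

record Graph : Set where
  field
    n    : ℕ
    m    : ℕ
    ends : Fin m → Fin n × Fin n

module _ (G : Graph) where
  open Graph G

  Vertex : Set
  Vertex = Fin n

  Edge : Set
  Edge = Fin m

  EdgeSet : Set
  EdgeSet = Subset m

  IsLoop : Edge → Set
  IsLoop e = proj₁ (ends e) ≡ proj₂ (ends e)

  LoopAt : Edge → Vertex → Set
  LoopAt e v = ends e ≡ (v , v)

  Joins : Edge → Vertex → Vertex → Set
  Joins e a b = (ends e ≡ (a , b)) ⊎ (ends e ≡ (b , a))

  incidence : Vertex → Edge → ℕ
  incidence v e =
    (if does (v ≟ proj₁ (ends e)) then 1 else 0) +
    (if does (v ≟ proj₂ (ends e)) then 1 else 0)

  deg : EdgeSet → Vertex → ℕ
  deg S v = sum (map (λ e → if does (e ∈? S) then incidence v e else 0) (allFin m))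
    where open import Data.Fin.Subset.Properties using (_∈?_)

  VertexOf : EdgeSet → Vertex → Set
  VertexOf S v = ∃[ e ] (e ∈ S × (proj₁ (ends e) ≡ v ⊎ proj₂ (ends e) ≡ v))

  data Reach (S : EdgeSet) : Vertex → Vertex → Set where
    here : ∀ {u} → Reach S u u
    step : ∀ {u w v} (e : Edge) → e ∈ S → Joins e u w → Reach S w v → Reach S u v

  ConnectedSet : EdgeSet → Set
  ConnectedSet S = ∀ u v → VertexOf S u → VertexOf S v → Reach S u v

  GraphConnected : Set
  GraphConnected = ∀ (u v : Vertex) → Reach ⊤ u v

  -- cycle: nonempty connected 2-regular subgraph (includes loops and 2-cycles)
  Cycle : EdgeSet → Set
  Cycle C = Nonempty C × ConnectedSet C × (∀ v → VertexOf C v → deg C v ≡ 2)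

  PathBetween : EdgeSet → Vertex → Vertex → Set
  PathBetween P u v =
    u ≢ v × ConnectedSet P × deg P u ≡ 1 × deg P v ≡ 1 ×
    (∀ w → VertexOf P w → w ≢ u → w ≢ v → deg P w ≡ 2)

  InternallyDisjoint : EdgeSet → EdgeSet → Vertex → Vertex → Set
  InternallyDisjoint P Q u v = ∀ w → VertexOf P w → VertexOf Q w → (w ≡ u ⊎ w ≡ v)

  EdgeDisjoint : EdgeSet → EdgeSet → Set
  EdgeDisjoint S R = ∀ e → e ∈ S → e ∉ R

  Theta : EdgeSet → Set
  Theta T = ∃[ u ] ∃[ v ] ∃[ P₁ ] ∃[ P₂ ] ∃[ P₃ ]
    ( PathBetween P₁ u v × PathBetween P₂ u v × PathBetween P₃ u v
    × InternallyDisjoint P₁ P₂ u v × InternallyDisjoint P₁ P₃ u v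
    × InternallyDisjoint P₂ P₃ u v
    × EdgeDisjoint P₁ P₂ × EdgeDisjoint P₁ P₃ × EdgeDisjoint P₂ P₃
    × T ≡ (P₁ ∪ P₂) ∪ P₃ )

  VertexDisjoint : EdgeSet → EdgeSet → Set
  VertexDisjoint S R = ∀ v → VertexOf S v → ¬ VertexOf R v

  TightHandcuff : EdgeSet → EdgeSet → Set
  TightHandcuff C₁ C₂ = Cycle C₁ × Cycle C₂ × EdgeDisjoint C₁ C₂ ×
    (∃[ w ] (VertexOf C₁ w × VertexOf C₂ w ×
      (∀ x → VertexOf C₁ x → VertexOf C₂ x → x ≡ w)))

  LooseHandcuff : EdgeSet → EdgeSet → EdgeSet → Set
  LooseHandcuff C₁ C₂ P = Cycle C₁ × Cycle C₂ × VertexDisjoint C₁ C₂ ×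
    (∃[ u ] ∃[ v ] ( PathBetween P u v
      × VertexOf C₁ u × VertexOf C₂ v
      × (∀ x → VertexOf P x → VertexOf C₁ x → x ≡ u)
      × (∀ x → VertexOf P x → VertexOf C₂ x → x ≡ v)))

  record QuasiBiased (B L F : EdgeSet → Set) : Set where
    field
      B-cycle : ∀ C → B C → Cycle C
      L-cycle : ∀ C → L C → Cycle C
      F-cycle : ∀ C → F C → Cycle C
      cover   : ∀ C → Cycle C → B C ⊎ L C ⊎ F C
      B∩L     : ∀ C → B C → ¬ L C
      B∩F     : ∀ C → B C → ¬ F C
      L∩F     : ∀ C → L C → ¬ F C
      theta   : ∀ T → Theta T → ¬ (∃[ C₁ ] ∃[ C₂ ]
                  ( C₁ ≢ C₂ × Cycle C₁ × C₁ ⊆ T × B C₁ × Cycle C₂ × C₂ ⊆ T × B C₂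
                  × (∀ C → Cycle C → C ⊆ T → B C → C ≡ C₁ ⊎ C ≡ C₂)))
      LF      : ∀ C D → L C → F D → ∃[ v ] (VertexOf C v × VertexOf D v)

  Circuit : (B L F : EdgeSet → Set) → EdgeSet → Set
  Circuit B L F S =
      (Cycle S × B S)
    ⊎ (Theta S × (∀ C → Cycle C → C ⊆ S → ¬ B C))
    ⊎ (∃[ C₁ ] ∃[ C₂ ] (TightHandcuff C₁ C₂ × ¬ B C₁ × ¬ B C₂ × S ≡ C₁ ∪ C₂))
    ⊎ (∃[ C₁ ] ∃[ C₂ ] (Cycle C₁ × Cycle C₂ × VertexDisjoint C₁ C₂
                        × L C₁ × L C₂ × S ≡ C₁ ∪ C₂))
    ⊎ (∃[ C₁ ] ∃[ C₂ ] ∃[ P ] (LooseHandcuff C₁ C₂ P × F C₁ × F C₂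
                        × S ≡ (C₁ ∪ C₂) ∪ P))

module _ {k : ℕ} (Circ : Subset k → Set) where

  Independent : Subset k → Set
  Independent I = ∀ C → Circ C → ¬ (C ⊆ I)

  HasRank : ℕ → Set
  HasRank r = (∃[ I ] (Independent I × ∣ I ∣ ≡ r)) × (∀ I → Independent I → ∣ I ∣ ≤ r)

  Loopless : Set
  Loopless = ∀ e → ¬ Circ ⁅ e ⁆

  -- parallel elements (in a loopless matroid)
  Parallel : Fin k → Fin k → Set
  Parallel e f = e ≡ f ⊎ Circ (⁅ e ⁆ ∪ ⁅ f ⁆)

  ParallelClass : Subset k → Set
  ParallelClass X = Nonempty X × (∀ e → e ∈ X → ∀ f → (f ∈ X ⇔ Parallel e f))

  MConnected : Set
  MConnected = ∀ e f → e ≢ f → ∃[ C ] (Circ C × e ∈ C × f ∈ C)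

module _ (G : Graph) (B L F : EdgeSet G → Set) where
  open Graph G

  Outcome-i : EdgeSet G → EdgeSet G → Set
  Outcome-i X Y = n ≡ 3 × (∀ e → ¬ IsLoop G e) × (∀ C → Cycle G C → B C)
    × ∃[ a ] ∃[ b ] ∃[ c ] ∃[ d ]
        ( a ≢ b × c ≢ d × ¬ ((a ≡ c × b ≡ d) ⊎ (a ≡ d × b ≡ c))
        × (∀ e → e ∈ X ⇔ Joins G e a b)
        × (∀ e → e ∈ Y ⇔ Joins G e c d))

  Outcome-ii : EdgeSet G → EdgeSet G → Set
  Outcome-ii X Y = n ≡ 2 × (∀ e → ¬ IsLoop G e)
    × (∀ C → Cycle G C → (B C ⇔ (C ⊆ X ⊎ C ⊆ Y)))

  Outcome-iii : EdgeSet G → EdgeSet G → Set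
  Outcome-iii X' Y' = n ≡ 2
    × (∃[ v ] (∀ e → e ∈ X' → LoopAt G e v × ¬ B ⁅ e ⁆))
    × (∃[ u ] ∃[ w ] (u ≢ w × (∀ e → e ∈ Y' ⇔ Joins G e u w)))

  Outcome-iv : EdgeSet G → EdgeSet G → Set
  Outcome-iv X' Y' = n ≡ 2
    × (∀ v → ∃[ e ] LoopAt G e v)
    × (∀ e → IsLoop G e → L ⁅ e ⁆)
    × (∀ e → e ∈ X' ⇔ IsLoop G e)
    × (∀ e → e ∈ Y' ⇔ (¬ IsLoop G e))

{-# OPTIONS --safe #-}
module Submission where

-- In a loopless matroid of rank two any three elements are dependent. If some element lay
-- outside X ∪ Y, then any two elements e, f would have a third element z parallel to neither,
-- and a circuit inside {e, f, z} would contain both e and f, so M would be connected; hence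
-- the edges of G split into X and Y. Every vertex of a circuit has degree at least two, so the
-- edges of a parallel class are either all loops or all links joining one pair of vertices.
-- Connectivity of G leaves four shapes. Two classes of loops cannot occur: two unbalanced loops
-- at the only vertex form a tight handcuff. Loops and links give (iii) when the loops sit at one
-- vertex and (iv) otherwise, since two loops at different vertices can only form a circuit as a
-- pair of cycles of L. Two classes of links share both ends, giving (ii), or exactly one end,
-- giving (i): every cycle is then a digon, and a two-edge circuit of links can only be a
-- balanced cycle.

open import Defs
open import Data.Bool using (if_then_else_)
open import Data.Empty using (⊥; ⊥-elim)
open import Data.Fin using (Fin; zero; suc; punchIn)
open import Data.Fin.Properties using (_≟_; any?; punchInᵢ≢i; cantor-schröder-bernstein)
open import Data.Fin.Subset using (Subset; _∈_; _∉_; _⊆_; _∪_; ∣_∣; ⁅_⁆; Nonempty)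
open import Data.Fin.Subset.Properties
  using (_∈?_; x∈⁅x⁆; x∈⁅y⁆⇒x≡y; x∈p∪q⁻; x∈p∪q⁺; p⊆p∪q; q⊆p∪q; ⊆-antisym; ∪-comm; ∣⁅x⁆∣≡1; p⊂q⇒∣p∣<∣q∣)
open import Data.List using (tabulate)
open import Data.List.Properties using (map-tabulate)
open import Data.Nat using (ℕ; zero; suc; _+_; _≤_; z≤n; s≤s)
open import Data.Nat.ListAction using () renaming (sum to listSum)
open import Data.Nat.Properties
  using (+-0-commutativeMonoid; +-mono-≤; +-identityʳ; ≤-refl; ≤-reflexive; ≤-trans)
import Data.Nat.Properties as ℕ
open import Data.Product using (∃-syntax; _×_; _,_; proj₁; proj₂)
open import Data.Sum using (_⊎_; inj₁; inj₂; [_,_]′)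
import Data.Sum as Sum
open import Data.Vec.Functional using (Vector)
open import Function using (_∘_; id; flip)
open import Function.Bundles using (Equivalence; _⇔_; mk⇔)
open import Function.Definitions using (Injective)
open import Relation.Nullary using (¬_; Dec; does; yes; no)
open import Relation.Nullary.Decidable using (_×-dec_; _⊎-dec_; ¬?; decidable-stable)
open import Relation.Binary.PropositionalEquality
  using (_≡_; _≢_; refl; sym; trans; cong; cong₂; subst; subst₂; module ≡-Reasoning)

open import Algebra.Properties.CommutativeMonoid.Sum +-0-commutativeMonoid
  using (sum; sum-cong-≗; sum-replicate-zero; ∑-distrib-+; sum-remove)

-- Finite sums and finite sets

listSum-tabulate : ∀ {n} (f : Vector ℕ n) → listSum (tabulate f) ≡ sum f
listSum-tabulate {zero}  f = refl
listSum-tabulate {suc n} f = cong (f zero +_) (listSum-tabulate (f ∘ suc))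

sum-mono-≤ : ∀ {n} {f g : Vector ℕ n} → (∀ i → f i ≤ g i) → sum f ≤ sum g
sum-mono-≤ {zero}  f≤g = z≤n
sum-mono-≤ {suc n} f≤g = +-mono-≤ (f≤g zero) (sum-mono-≤ (f≤g ∘ suc))

sum-zero : ∀ {n} {f : Vector ℕ n} → (∀ i → f i ≡ 0) → sum f ≡ 0
sum-zero {n} f≡0 = trans (sum-cong-≗ f≡0) (sum-replicate-zero n)

sum-single : ∀ {n} (f : Vector ℕ n) i → (∀ j → j ≢ i → f j ≡ 0) → sum f ≡ f i
sum-single {suc n} f i others = begin
  sum f                       ≡⟨ sum-remove {i = i} f ⟩
  f i + sum (f ∘ punchIn i)   ≡⟨ cong (f i +_) (sum-zero (λ j → others _ (punchInᵢ≢i i j))) ⟩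
  f i + 0                     ≡⟨ +-identityʳ (f i) ⟩
  f i                         ∎
  where open ≡-Reasoning

module _ {n : ℕ} {x y : Fin n} where

  ∈-pair : ∀ {z} → z ∈ ⁅ x ⁆ ∪ ⁅ y ⁆ → z ≡ x ⊎ z ≡ y
  ∈-pair z∈pair = Sum.map (x∈⁅y⁆⇒x≡y x) (x∈⁅y⁆⇒x≡y y) (x∈p∪q⁻ ⁅ x ⁆ ⁅ y ⁆ z∈pair)

  x∈pair : x ∈ ⁅ x ⁆ ∪ ⁅ y ⁆
  x∈pair = x∈p∪q⁺ (inj₁ (x∈⁅x⁆ x))

  y∈pair : y ∈ ⁅ x ⁆ ∪ ⁅ y ⁆
  y∈pair = x∈p∪q⁺ (inj₂ (x∈⁅x⁆ y))

  pair-swap : ∀ {z} → z ∈ ⁅ x ⁆ ∪ ⁅ y ⁆ → z ∈ ⁅ y ⁆ ∪ ⁅ x ⁆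
  pair-swap {z} = subst (z ∈_) (∪-comm ⁅ x ⁆ ⁅ y ⁆)

  pair⊆ : ∀ {S} → x ∈ S → y ∈ S → ⁅ x ⁆ ∪ ⁅ y ⁆ ⊆ S
  pair⊆ x∈S y∈S z∈pair = [ (λ { refl → x∈S }) , (λ { refl → y∈S }) ]′ (∈-pair z∈pair)

  ⊆-pair⇒≡⁅⁆ : ∀ {S} → S ⊆ ⁅ x ⁆ ∪ ⁅ y ⁆ → x ∈ S → y ∉ S → S ≡ ⁅ x ⁆
  ⊆-pair⇒≡⁅⁆ {S} S⊆pair x∈S y∉S = ⊆-antisym S⊆⁅x⁆ ⁅x⁆⊆S
    where
    S⊆⁅x⁆ : S ⊆ ⁅ x ⁆
    S⊆⁅x⁆ z∈S = [ (λ { refl → x∈⁅x⁆ x }) , (λ { refl → ⊥-elim (y∉S z∈S) }) ]′ (∈-pair (S⊆pair z∈S))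
    ⁅x⁆⊆S : ⁅ x ⁆ ⊆ S
    ⁅x⁆⊆S z∈⁅x⁆ = subst (_∈ S) (sym (x∈⁅y⁆⇒x≡y x z∈⁅x⁆)) x∈S

  disjoint-parts-of-pair : ∀ {S T} → x ∈ S → Nonempty T → (∀ e → e ∈ S → e ∉ T) →
                           S ⊆ ⁅ x ⁆ ∪ ⁅ y ⁆ → T ⊆ ⁅ x ⁆ ∪ ⁅ y ⁆ → S ≡ ⁅ x ⁆
  disjoint-parts-of-pair x∈S (z , z∈T) S∩T≡∅ S⊆pair T⊆pair =
    ⊆-pair⇒≡⁅⁆ S⊆pair x∈S (λ y∈S → S∩T≡∅ z (pair⊆ x∈S y∈S (T⊆pair z∈T)) z∈T)

∈-triple : ∀ {n} {x y z g : Fin n} → g ∈ (⁅ x ⁆ ∪ ⁅ y ⁆) ∪ ⁅ z ⁆ → g ≡ x ⊎ g ≡ y ⊎ g ≡ z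
∈-triple {x = x} {y} {z} g∈triple =
  [ Sum.map₂ inj₁ ∘ ∈-pair , inj₂ ∘ inj₂ ∘ x∈⁅y⁆⇒x≡y z ]′ (x∈p∪q⁻ (⁅ x ⁆ ∪ ⁅ y ⁆) ⁅ z ⁆ g∈triple)

3≤∣triple∣ : ∀ {n} {x y z : Fin n} → x ≢ y → x ≢ z → y ≢ z → 3 ≤ ∣ (⁅ x ⁆ ∪ ⁅ y ⁆) ∪ ⁅ z ⁆ ∣
3≤∣triple∣ {x = x} {y} {z} x≢y x≢z y≢z = begin
  3                             ≡⟨ cong (2 +_) (∣⁅x⁆∣≡1 x) ⟨
  2 + ∣ ⁅ x ⁆ ∣                 ≤⟨ s≤s (p⊂q⇒∣p∣<∣q∣ (p⊆p∪q ⁅ y ⁆ , y , y∈pair , x≢y ∘ sym ∘ x∈⁅y⁆⇒x≡y x)) ⟩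
  1 + ∣ ⁅ x ⁆ ∪ ⁅ y ⁆ ∣         ≤⟨ p⊂q⇒∣p∣<∣q∣ (p⊆p∪q ⁅ z ⁆ , z , x∈p∪q⁺ (inj₂ (x∈⁅x⁆ z)) , z∉pair) ⟩
  ∣ (⁅ x ⁆ ∪ ⁅ y ⁆) ∪ ⁅ z ⁆ ∣   ∎
  where
  open ℕ.≤-Reasoning
  z∉pair : z ∉ ⁅ x ⁆ ∪ ⁅ y ⁆
  z∉pair = [ x≢z ∘ sym , y≢z ∘ sym ]′ ∘ ∈-pair

pigeonhole-pair : ∀ {A : Set} {x y a b c : A} → a ≡ x ⊎ a ≡ y → b ≡ x ⊎ b ≡ y → c ≡ x ⊎ c ≡ y →
                  a ≢ b → a ≢ c → b ≢ c → ⊥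
pigeonhole-pair (inj₁ refl) (inj₁ refl) _           a≢b _   _   = a≢b refl
pigeonhole-pair (inj₂ refl) (inj₂ refl) _           a≢b _   _   = a≢b refl
pigeonhole-pair (inj₁ refl) (inj₂ refl) (inj₁ refl) _   a≢c _   = a≢c refl
pigeonhole-pair (inj₁ refl) (inj₂ refl) (inj₂ refl) _   _   b≢c = b≢c refl
pigeonhole-pair (inj₂ refl) (inj₁ refl) (inj₁ refl) _   _   b≢c = b≢c refl
pigeonhole-pair (inj₂ refl) (inj₁ refl) (inj₂ refl) _   a≢c _   = a≢c refl

¬¬-→ : ∀ {A B : Set} → (A → ¬ ¬ B) → ¬ ¬ (A → B)
¬¬-→ f ¬[A→B] = ¬[A→B] (λ a → ⊥-elim (f a (λ b → ¬[A→B] (λ _ → b))))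

¬¬-∀-Fin : ∀ {n} {P : Fin n → Set} → (∀ i → ¬ ¬ P i) → ¬ ¬ (∀ i → P i)
¬¬-∀-Fin {zero}  _   ¬∀ = ¬∀ (λ ())
¬¬-∀-Fin {suc n} ¬¬P ¬∀ = ¬¬P zero λ P₀ → ¬¬-∀-Fin (¬¬P ∘ suc) λ P₊ → ¬∀ λ { zero → P₀ ; (suc i) → P₊ i }

injective-onto⇒≡ : ∀ {k n} (f : Fin k → Fin n) → Injective _≡_ _≡_ f → (∀ v → ∃[ i ] f i ≡ v) → n ≡ k
injective-onto⇒≡ f f-injective f-onto = cantor-schröder-bernstein preimage-injective f-injective
  where
  preimage-injective : Injective _≡_ _≡_ (proj₁ ∘ f-onto)
  preimage-injective {v} {w} eq = trans (sym (proj₂ (f-onto v))) (trans (cong f eq) (proj₂ (f-onto w)))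

module _ {n : ℕ} where

  exactly-two : ∀ {u w : Fin n} → u ≢ w → (∀ v → v ≡ u ⊎ v ≡ w) → n ≡ 2
  exactly-two {u} {w} u≢w two = injective-onto⇒≡ f injective onto
    where
    f : Fin 2 → Fin n
    f zero    = u
    f (suc _) = w
    injective : Injective _≡_ _≡_ f
    injective {zero}     {zero}     _  = refl
    injective {zero}     {suc zero} eq = ⊥-elim (u≢w eq)
    injective {suc zero} {zero}     eq = ⊥-elim (u≢w (sym eq))
    injective {suc zero} {suc zero} _  = refl
    onto : ∀ v → ∃[ i ] f i ≡ v
    onto v = [ (λ v≡u → zero , sym v≡u) , (λ v≡w → suc zero , sym v≡w) ]′ (two v)

  exactly-three : ∀ {s p q : Fin n} → s ≢ p → s ≢ q → p ≢ q → (∀ v → v ≡ s ⊎ v ≡ p ⊎ v ≡ q) → n ≡ 3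
  exactly-three {s} {p} {q} s≢p s≢q p≢q three = injective-onto⇒≡ f injective onto
    where
    f : Fin 3 → Fin n
    f zero          = s
    f (suc zero)    = p
    f (suc (suc _)) = q
    injective : Injective _≡_ _≡_ f
    injective {zero}           {zero}           _  = refl
    injective {zero}           {suc zero}       eq = ⊥-elim (s≢p eq)
    injective {zero}           {suc (suc zero)} eq = ⊥-elim (s≢q eq)
    injective {suc zero}       {zero}           eq = ⊥-elim (s≢p (sym eq))
    injective {suc zero}       {suc zero}       _  = refl
    injective {suc zero}       {suc (suc zero)} eq = ⊥-elim (p≢q eq)
    injective {suc (suc zero)} {zero}           eq = ⊥-elim (s≢q (sym eq))
    injective {suc (suc zero)} {suc zero}       eq = ⊥-elim (p≢q (sym eq))
    injective {suc (suc zero)} {suc (suc zero)} _  = refl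
    onto : ∀ v → ∃[ i ] f i ≡ v
    onto v = [ (λ v≡s → zero , sym v≡s)
             , [ (λ v≡p → suc zero , sym v≡p) , (λ v≡q → suc (suc zero) , sym v≡q) ]′
             ]′ (three v)

-- Parallel classes of a matroid given by its circuits

module ParallelClasses {k : ℕ} (Circ : Subset k → Set) where

  private
    variable
      e f z : Fin k
      C K X Y : Subset k

  Parallel-sym : Parallel Circ e f → Parallel Circ f e
  Parallel-sym {e} {f} = Sum.map sym (subst Circ (∪-comm ⁅ e ⁆ ⁅ f ⁆))

  ParallelClass-closed : ParallelClass Circ K → e ∈ K → Parallel Circ e f → f ∈ K
  ParallelClass-closed (_ , class) e∈K = Equivalence.from (class _ e∈K _)

  ParallelClass-circuit : ParallelClass Circ K → e ∈ K → f ∈ K → e ≢ f → Circ (⁅ e ⁆ ∪ ⁅ f ⁆)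
  ParallelClass-circuit (_ , class) e∈K f∈K e≢f =
    [ ⊥-elim ∘ e≢f , id ]′ (Equivalence.to (class _ e∈K _) f∈K)

  ParallelClass-separates : ParallelClass Circ K → e ∈ K → f ∉ K → ¬ Parallel Circ e f
  ParallelClass-separates K-class e∈K f∉K = f∉K ∘ ParallelClass-closed K-class e∈K

  ParallelClasses-disjoint : ParallelClass Circ X → ParallelClass Circ Y → X ≢ Y → e ∈ X → e ∉ Y
  ParallelClasses-disjoint X-class Y-class X≢Y e∈X e∈Y =
    X≢Y (⊆-antisym (⊆-class X-class Y-class e∈X e∈Y) (⊆-class Y-class X-class e∈Y e∈X))
    where
    ⊆-class : ParallelClass Circ X → ParallelClass Circ Y → e ∈ X → e ∈ Y → X ⊆ Y
    ⊆-class (_ , X-class) Y-class e∈X e∈Y f∈X =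
      ParallelClass-closed Y-class e∈Y (Equivalence.to (X-class _ e∈X _) f∈X)

  module _ (loopless : Loopless Circ) (rank : HasRank Circ 2) where

    no-circuit-⊆-nonparallel-pair : ¬ Parallel Circ e f → C ⊆ ⁅ e ⁆ ∪ ⁅ f ⁆ → ¬ Circ C
    no-circuit-⊆-nonparallel-pair {e} {f} {C} e∦f C⊆pair circuit with e ∈? C | f ∈? C
    ... | yes e∈C | yes f∈C = e∦f (inj₂ (subst Circ (⊆-antisym C⊆pair (pair⊆ e∈C f∈C)) circuit))
    ... | yes e∈C | no f∉C  = loopless e (subst Circ (⊆-pair⇒≡⁅⁆ C⊆pair e∈C f∉C) circuit)
    ... | no e∉C  | yes f∈C = loopless f (subst Circ (⊆-pair⇒≡⁅⁆ (pair-swap ∘ C⊆pair) f∈C e∉C) circuit)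
    ... | no e∉C  | no f∉C  = independent C circuit λ g∈C →
      ⊥-elim ([ (λ { refl → e∉C g∈C }) , (λ { refl → f∉C g∈C }) ]′ (∈-pair (C⊆pair g∈C)))
      where
      independent : Independent Circ (proj₁ (proj₁ rank))
      independent = proj₁ (proj₂ (proj₁ rank))

    -- {e, f, z} is dependent; a circuit inside it contains e and f since {e, z} and {f, z} contain none.
    common-circuit : e ≢ f → ¬ Parallel Circ e z → ¬ Parallel Circ f z →
                     ¬ ¬ (∃[ C ] (Circ C × e ∈ C × f ∈ C))
    common-circuit {e} {f} {z} e≢f e∦z f∦z no-common =
      ℕ.n≮n 2 (≤-trans (3≤∣triple∣ e≢f (e∦z ∘ inj₁) (f∦z ∘ inj₁)) (proj₂ rank _ independent))
      where
      independent : Independent Circ ((⁅ e ⁆ ∪ ⁅ f ⁆) ∪ ⁅ z ⁆)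
      independent C circuit C⊆triple with e ∈? C | f ∈? C
      ... | yes e∈C | yes f∈C = no-common (C , circuit , e∈C , f∈C)
      ... | no e∉C  | _       = no-circuit-⊆-nonparallel-pair f∦z C⊆fz circuit
        where
        C⊆fz : C ⊆ ⁅ f ⁆ ∪ ⁅ z ⁆
        C⊆fz g∈C with ∈-triple (C⊆triple g∈C)
        ... | inj₁ refl        = ⊥-elim (e∉C g∈C)
        ... | inj₂ (inj₁ refl) = x∈pair
        ... | inj₂ (inj₂ refl) = y∈pair
      ... | yes _   | no f∉C  = no-circuit-⊆-nonparallel-pair e∦z C⊆ez circuit
        where
        C⊆ez : C ⊆ ⁅ e ⁆ ∪ ⁅ z ⁆
        C⊆ez g∈C with ∈-triple (C⊆triple g∈C)
        ... | inj₁ refl        = x∈pair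
        ... | inj₂ (inj₁ refl) = ⊥-elim (f∉C g∈C)
        ... | inj₂ (inj₂ refl) = y∈pair

    -- Wherever e and f lie, one of x₀, y₀ and g is parallel to neither of them.
    ParallelClasses-cover : ¬ MConnected Circ → ParallelClass Circ X → ParallelClass Circ Y → X ≢ Y →
                            ∀ g → g ∈ X ⊎ g ∈ Y
    ParallelClasses-cover {X} {Y} ¬connected X-class@((x₀ , x₀∈X) , _) Y-class@((y₀ , y₀∈Y) , _) X≢Y g
      with g ∈? X | g ∈? Y
    ... | yes g∈X | _       = inj₁ g∈X
    ... | no _    | yes g∈Y = inj₂ g∈Y
    ... | no g∉X  | no g∉Y  =
      ⊥-elim (¬¬-∀-Fin (λ e → ¬¬-∀-Fin (λ f → ¬¬-→ (λ e≢f → common e≢f (separator e f)))) ¬connected)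
      where
      common : e ≢ f → ∃[ z ] (¬ Parallel Circ e z × ¬ Parallel Circ f z) →
               ¬ ¬ (∃[ C ] (Circ C × e ∈ C × f ∈ C))
      common e≢f (_ , e∦z , f∦z) = common-circuit e≢f e∦z f∦z
      outside : ParallelClass Circ K → z ∈ K → e ∉ K → ¬ Parallel Circ e z
      outside K-class z∈K e∉K = ParallelClass-separates K-class z∈K e∉K ∘ Parallel-sym
      X∩Y≡∅ : e ∈ X → e ∉ Y
      X∩Y≡∅ = ParallelClasses-disjoint X-class Y-class X≢Y
      separator : ∀ e f → ∃[ z ] (¬ Parallel Circ e z × ¬ Parallel Circ f z)
      separator e f with e ∈? X | f ∈? X | e ∈? Y | f ∈? Y
      ... | no e∉X  | no f∉X  | _       | _       =
        x₀ , outside X-class x₀∈X e∉X , outside X-class x₀∈X f∉X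
      ... | _       | _       | no e∉Y  | no f∉Y  =
        y₀ , outside Y-class y₀∈Y e∉Y , outside Y-class y₀∈Y f∉Y
      ... | yes e∈X | _       | _       | yes f∈Y =
        g , ParallelClass-separates X-class e∈X g∉X , ParallelClass-separates Y-class f∈Y g∉Y
      ... | _       | yes f∈X | yes e∈Y | _       =
        g , ParallelClass-separates Y-class e∈Y g∉Y , ParallelClass-separates X-class f∈X g∉X
      ... | yes e∈X | no _    | yes e∈Y | no _    = ⊥-elim (X∩Y≡∅ e∈X e∈Y)
      ... | no _    | yes f∈X | no _    | yes f∈Y = ⊥-elim (X∩Y≡∅ f∈X f∈Y)

-- Ends, incidences and degrees

module GraphProperties (G : Graph) where
  open Graph G

  private
    variable
      e f g x y : Edge G
      u v w a b : Vertex G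
      S T C P : EdgeSet G

  IsEnd : Edge G → Vertex G → Set
  IsEnd e v = proj₁ (ends e) ≡ v ⊎ proj₂ (ends e) ≡ v

  IsEnd? : ∀ e v → Dec (IsEnd e v)
  IsEnd? e v = (proj₁ (ends e) ≟ v) ⊎-dec (proj₂ (ends e) ≟ v)

  IsLoop? : ∀ e → Dec (IsLoop G e)
  IsLoop? e = proj₁ (ends e) ≟ proj₂ (ends e)

  LoopAt⇒IsLoop : LoopAt G e v → IsLoop G e
  LoopAt⇒IsLoop at = trans (cong proj₁ at) (sym (cong proj₂ at))

  LoopAt⇒IsEnd : LoopAt G e v → IsEnd e v
  LoopAt⇒IsEnd at = inj₁ (cong proj₁ at)

  IsLoop⇒LoopAt : IsLoop G e → LoopAt G e (proj₁ (ends e))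
  IsLoop⇒LoopAt {e} loop = cong (proj₁ (ends e) ,_) (sym loop)

  LoopAt-IsEnd : LoopAt G e v → IsEnd e w → w ≡ v
  LoopAt-IsEnd at (inj₁ first)  = trans (sym first) (cong proj₁ at)
  LoopAt-IsEnd at (inj₂ second) = trans (sym second) (cong proj₂ at)

  IsEnd-loop : IsLoop G e → IsEnd e v → v ≡ proj₁ (ends e)
  IsEnd-loop = LoopAt-IsEnd ∘ IsLoop⇒LoopAt

  Joins-sym : Joins G e u w → Joins G e w u
  Joins-sym = [ inj₂ , inj₁ ]′

  Joins⇒IsEnd₁ : Joins G e u w → IsEnd e u
  Joins⇒IsEnd₁ (inj₁ eq) = inj₁ (cong proj₁ eq)
  Joins⇒IsEnd₁ (inj₂ eq) = inj₂ (cong proj₂ eq)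

  Joins⇒IsEnd₂ : Joins G e u w → IsEnd e w
  Joins⇒IsEnd₂ = Joins⇒IsEnd₁ ∘ Joins-sym

  IsEnd-Joins : Joins G e u w → IsEnd e v → v ≡ u ⊎ v ≡ w
  IsEnd-Joins (inj₁ eq) (inj₁ first)  = inj₁ (trans (sym first) (cong proj₁ eq))
  IsEnd-Joins (inj₁ eq) (inj₂ second) = inj₂ (trans (sym second) (cong proj₂ eq))
  IsEnd-Joins (inj₂ eq) (inj₁ first)  = inj₂ (trans (sym first) (cong proj₁ eq))
  IsEnd-Joins (inj₂ eq) (inj₂ second) = inj₁ (trans (sym second) (cong proj₂ eq))

  IsEnd₂⇒Joins : a ≢ b → IsEnd e a → IsEnd e b → Joins G e a b
  IsEnd₂⇒Joins a≢b (inj₁ p) (inj₁ q) = ⊥-elim (a≢b (trans (sym p) q))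
  IsEnd₂⇒Joins a≢b (inj₁ p) (inj₂ q) = inj₁ (cong₂ _,_ p q)
  IsEnd₂⇒Joins a≢b (inj₂ p) (inj₁ q) = inj₂ (cong₂ _,_ q p)
  IsEnd₂⇒Joins a≢b (inj₂ p) (inj₂ q) = ⊥-elim (a≢b (trans (sym p) q))

  Joins-resp-ends : Joins G e u w → Joins G f (proj₁ (ends e)) (proj₂ (ends e)) → Joins G f u w
  Joins-resp-ends (inj₁ eq) j = subst₂ (Joins G _) (cong proj₁ eq) (cong proj₂ eq) j
  Joins-resp-ends (inj₂ eq) j = Joins-sym (subst₂ (Joins G _) (cong proj₁ eq) (cong proj₂ eq) j)

  Joins-loop : IsLoop G e → Joins G e u w → u ≡ w
  Joins-loop loop j = trans (IsEnd-loop loop (Joins⇒IsEnd₁ j)) (sym (IsEnd-loop loop (Joins⇒IsEnd₂ j)))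

  Joins⇒¬IsLoop : u ≢ w → Joins G e u w → ¬ IsLoop G e
  Joins⇒¬IsLoop u≢w j loop = u≢w (Joins-loop loop j)

  incidence-¬IsEnd : ¬ IsEnd e v → incidence G v e ≡ 0
  incidence-¬IsEnd {e} {v} ¬end with v ≟ proj₁ (ends e) | v ≟ proj₂ (ends e)
  ... | yes p | _     = ⊥-elim (¬end (inj₁ (sym p)))
  ... | no _  | yes q = ⊥-elim (¬end (inj₂ (sym q)))
  ... | no _  | no _  = refl

  incidence≢0⇒IsEnd : incidence G v e ≢ 0 → IsEnd e v
  incidence≢0⇒IsEnd {v} {e} incidence≢0 = decidable-stable (IsEnd? e v) (incidence≢0 ∘ incidence-¬IsEnd)

  IsEnd⇒1≤incidence : IsEnd e v → 1 ≤ incidence G v e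
  IsEnd⇒1≤incidence {e} {v} end with v ≟ proj₁ (ends e) | v ≟ proj₂ (ends e)
  ... | yes _ | _     = s≤s z≤n
  ... | no _  | yes _ = s≤s z≤n
  ... | no p  | no q  = ⊥-elim ([ p ∘ sym , q ∘ sym ]′ end)

  incidence-link : ¬ IsLoop G e → IsEnd e v → incidence G v e ≡ 1
  incidence-link {e} {v} link end with v ≟ proj₁ (ends e) | v ≟ proj₂ (ends e)
  ... | yes p | yes q = ⊥-elim (link (trans (sym p) q))
  ... | yes _ | no _  = refl
  ... | no _  | yes _ = refl
  ... | no p  | no q  = ⊥-elim ([ p ∘ sym , q ∘ sym ]′ end)

  incidence-loop : IsLoop G e → IsEnd e v → incidence G v e ≡ 2
  incidence-loop {e} {v} loop end with v ≟ proj₁ (ends e) | v ≟ proj₂ (ends e)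
  ... | yes _ | yes _ = refl
  ... | yes p | no q  = ⊥-elim (q (trans p loop))
  ... | no p  | _     = ⊥-elim (p (IsEnd-loop loop end))

  degTerm : EdgeSet G → Vertex G → Edge G → ℕ
  degTerm S v e = if does (e ∈? S) then incidence G v e else 0

  deg≡sum : ∀ S v → deg G S v ≡ sum (degTerm S v)
  deg≡sum S v = trans (cong listSum (map-tabulate id (degTerm S v))) (listSum-tabulate (degTerm S v))

  degTerm-∈ : e ∈ S → ∀ v → degTerm S v e ≡ incidence G v e
  degTerm-∈ {e} {S} e∈S v with e ∈? S
  ... | yes _  = refl
  ... | no e∉S = ⊥-elim (e∉S e∈S)

  degTerm-∉ : e ∉ S → ∀ v → degTerm S v e ≡ 0
  degTerm-∉ {e} {S} e∉S v with e ∈? S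
  ... | yes e∈S = ⊥-elim (e∉S e∈S)
  ... | no _    = refl

  deg-mono-at : ∀ v → (∀ e → e ∈ S → IsEnd e v → e ∈ T) → deg G S v ≤ deg G T v
  deg-mono-at {S} {T} v S⊆T = subst₂ _≤_ (sym (deg≡sum S v)) (sym (deg≡sum T v)) (sum-mono-≤ term-mono)
    where
    term-mono : ∀ e → degTerm S v e ≤ degTerm T v e
    term-mono e with e ∈? S | e ∈? T | IsEnd? e v
    ... | no _    | _      | _       = z≤n
    ... | yes _   | yes _  | _       = ≤-refl
    ... | yes e∈S | no e∉T | yes end = ⊥-elim (e∉T (S⊆T e e∈S end))
    ... | yes _   | no _   | no ¬end = ≤-reflexive (incidence-¬IsEnd ¬end)

  deg-mono : S ⊆ T → ∀ v → deg G S v ≤ deg G T v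
  deg-mono S⊆T v = deg-mono-at v (λ _ e∈S _ → S⊆T e∈S)

  deg-⁅⁆ : ∀ e v → deg G ⁅ e ⁆ v ≡ incidence G v e
  deg-⁅⁆ e v = begin
    deg G ⁅ e ⁆ v         ≡⟨ deg≡sum ⁅ e ⁆ v ⟩
    sum (degTerm ⁅ e ⁆ v) ≡⟨ sum-single _ e (λ f f≢e → degTerm-∉ (f≢e ∘ x∈⁅y⁆⇒x≡y e) v) ⟩
    degTerm ⁅ e ⁆ v e     ≡⟨ degTerm-∈ (x∈⁅x⁆ e) v ⟩
    incidence G v e       ∎
    where open ≡-Reasoning

  deg-∪ : EdgeDisjoint G S T → ∀ v → deg G (S ∪ T) v ≡ deg G S v + deg G T v
  deg-∪ {S} {T} S∩T≡∅ v = begin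
    deg G (S ∪ T) v                           ≡⟨ deg≡sum (S ∪ T) v ⟩
    sum (degTerm (S ∪ T) v)                   ≡⟨ sum-cong-≗ term-∪ ⟩
    sum (λ e → degTerm S v e + degTerm T v e) ≡⟨ ∑-distrib-+ (degTerm S v) (degTerm T v) ⟩
    sum (degTerm S v) + sum (degTerm T v)     ≡⟨ cong₂ _+_ (deg≡sum S v) (deg≡sum T v) ⟨
    deg G S v + deg G T v                     ∎
    where
    open ≡-Reasoning
    term-∪ : ∀ e → degTerm (S ∪ T) v e ≡ degTerm S v e + degTerm T v e
    term-∪ e with e ∈? S | e ∈? T
    ... | yes e∈S | yes e∈T = ⊥-elim (S∩T≡∅ e e∈S e∈T)
    ... | yes e∈S | no _    = trans (degTerm-∈ (x∈p∪q⁺ (inj₁ e∈S)) v) (sym (+-identityʳ _))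
    ... | no _    | yes e∈T = degTerm-∈ (x∈p∪q⁺ (inj₂ e∈T)) v
    ... | no e∉S  | no e∉T  = degTerm-∉ ([ e∉S , e∉T ]′ ∘ x∈p∪q⁻ S T) v

  ⁅⁆-disjoint : x ≢ y → EdgeDisjoint G ⁅ x ⁆ ⁅ y ⁆
  ⁅⁆-disjoint {x} {y} x≢y e e∈⁅x⁆ e∈⁅y⁆ = x≢y (trans (sym (x∈⁅y⁆⇒x≡y x e∈⁅x⁆)) (x∈⁅y⁆⇒x≡y y e∈⁅y⁆))

  deg-pair : x ≢ y → ∀ v → deg G (⁅ x ⁆ ∪ ⁅ y ⁆) v ≡ incidence G v x + incidence G v y
  deg-pair {x} {y} x≢y v = trans (deg-∪ (⁅⁆-disjoint x≢y) v) (cong₂ _+_ (deg-⁅⁆ x v) (deg-⁅⁆ y v))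

  incidence≤deg : e ∈ S → ∀ v → incidence G v e ≤ deg G S v
  incidence≤deg {e} {S} e∈S v =
    subst (_≤ deg G S v) (deg-⁅⁆ e v) (deg-mono (λ f∈⁅e⁆ → subst (_∈ S) (sym (x∈⁅y⁆⇒x≡y e f∈⁅e⁆)) e∈S) v)

  deg≢0⇒VertexOf : deg G S v ≢ 0 → VertexOf G S v
  deg≢0⇒VertexOf {S} {v} deg≢0 with any? (λ e → (e ∈? S) ×-dec IsEnd? e v)
  ... | yes edge = edge
  ... | no none  = ⊥-elim (deg≢0 (trans (deg≡sum S v) (sum-zero term≡0)))
    where
    term≡0 : ∀ e → degTerm S v e ≡ 0
    term≡0 e with e ∈? S
    ... | yes e∈S = incidence-¬IsEnd (λ end → none (e , e∈S , end))
    ... | no _    = refl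

  VertexOf-⁅⁆ : VertexOf G ⁅ e ⁆ v → IsEnd e v
  VertexOf-⁅⁆ {e} (f , f∈⁅e⁆ , end) = subst (λ g → IsEnd g _) (x∈⁅y⁆⇒x≡y e f∈⁅e⁆) end

  VertexOf-mono : S ⊆ T → VertexOf G S v → VertexOf G T v
  VertexOf-mono S⊆T (e , e∈S , end) = e , S⊆T e∈S , end

  VertexOf-∪ : VertexOf G (S ∪ T) v → VertexOf G S v ⊎ VertexOf G T v
  VertexOf-∪ {S} {T} (e , e∈S∪T , end) =
    Sum.map (λ e∈S → e , e∈S , end) (λ e∈T → e , e∈T , end) (x∈p∪q⁻ S T e∈S∪T)

  VertexDisjoint⇒EdgeDisjoint : VertexDisjoint G S T → EdgeDisjoint G S T
  VertexDisjoint⇒EdgeDisjoint disjoint e e∈S e∈T = disjoint _ (e , e∈S , inj₁ refl) (e , e∈T , inj₁ refl)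

  EdgeDisjoint⇒≢ : EdgeDisjoint G S T → e ∈ S → f ∈ T → e ≢ f
  EdgeDisjoint⇒≢ disjoint e∈S f∈T refl = disjoint _ e∈S f∈T

  Reach-invariant : (Q : Vertex G → Set) → (∀ e x y → e ∈ S → Joins G e x y → Q x → Q y) →
                    Reach G S u v → Q u → Q v
  Reach-invariant Q closed here             Qu = Qu
  Reach-invariant Q closed (step e e∈S j r) Qu = Reach-invariant Q closed r (closed e _ _ e∈S j Qu)

  connected-invariant : GraphConnected G → (Q : Vertex G → Set) →
                        (∀ e x y → Joins G e x y → Q x → Q y) → Q u → ∀ v → Q v
  connected-invariant connected Q closed Qu v =
    Reach-invariant Q (λ e x y _ → closed e x y) (connected _ v) Qu

  Reach-loops : (∀ e → e ∈ S → IsLoop G e) → Reach G S u v → u ≡ v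
  Reach-loops {u = u} loops r =
    Reach-invariant (u ≡_) (λ e x y e∈S j u≡x → trans u≡x (Joins-loop (loops e e∈S) j)) r refl

  loop-cycle : IsLoop G e → Cycle G ⁅ e ⁆
  loop-cycle {e} loop = (e , x∈⁅x⁆ e) , connected , deg≡2
    where
    at-loop : VertexOf G ⁅ e ⁆ v → v ≡ proj₁ (ends e)
    at-loop = IsEnd-loop loop ∘ VertexOf-⁅⁆
    connected : ConnectedSet G ⁅ e ⁆
    connected u v u∈⁅e⁆ v∈⁅e⁆ =
      subst (Reach G ⁅ e ⁆ u) (trans (at-loop u∈⁅e⁆) (sym (at-loop v∈⁅e⁆))) here
    deg≡2 : ∀ v → VertexOf G ⁅ e ⁆ v → deg G ⁅ e ⁆ v ≡ 2
    deg≡2 v v∈⁅e⁆ = trans (deg-⁅⁆ e v) (incidence-loop loop (VertexOf-⁅⁆ v∈⁅e⁆))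

  path-start : PathBetween G P u w → VertexOf G P u
  path-start (_ , _ , deg≡1 , _) = deg≢0⇒VertexOf (ℕ.1+n≢0 ∘ trans (sym deg≡1))

  path-end : PathBetween G P u w → VertexOf G P w
  path-end (_ , _ , _ , deg≡1 , _) = deg≢0⇒VertexOf (ℕ.1+n≢0 ∘ trans (sym deg≡1))

  -- A loop contributes 2 to the degree of its vertex, so a set of loops has no vertex of degree 1.
  no-path-of-loops : (∀ e → e ∈ P → IsLoop G e) → ¬ PathBetween G P u w
  no-path-of-loops {P} {u} loops path@(_ , _ , deg≡1 , _) with path-start path
  ... | e , e∈P , end = ℕ.n≮n 1 (begin
    2               ≡⟨ incidence-loop (loops e e∈P) end ⟨
    incidence G u e ≤⟨ incidence≤deg e∈P u ⟩
    deg G P u       ≡⟨ deg≡1 ⟩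
    1               ∎)
    where open ℕ.≤-Reasoning

  cycle-second-edge : Cycle G C → x ∈ C → ¬ IsLoop G x → IsEnd x v → ∃[ y ] (y ∈ C × y ≢ x × IsEnd y v)
  cycle-second-edge {C} {x} {v} (_ , _ , deg≡2) x∈C link x-end
    with any? (λ y → (y ∈? C) ×-dec ¬? (y ≟ x) ×-dec IsEnd? y v)
  ... | yes second = second
  ... | no none    = ⊥-elim (ℕ.n≮n 1 (begin
    2               ≡⟨ deg≡2 v (x , x∈C , x-end) ⟨
    deg G C v       ≤⟨ deg-mono-at v only-x ⟩
    deg G ⁅ x ⁆ v   ≡⟨ deg-⁅⁆ x v ⟩
    incidence G v x ≡⟨ incidence-link link x-end ⟩
    1               ∎))
    where
    open ℕ.≤-Reasoning
    only-x : ∀ g → g ∈ C → IsEnd g v → g ∈ ⁅ x ⁆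
    only-x g g∈C g-end with g ≟ x
    ... | yes refl = x∈⁅x⁆ x
    ... | no g≢x   = ⊥-elim (none (g , g∈C , g≢x , g-end))

  cycle-no-three-edges-at : Cycle G C → x ∈ C → y ∈ C → g ∈ C → x ≢ y → g ≢ x → g ≢ y →
                            IsEnd x v → IsEnd y v → ¬ IsEnd g v
  cycle-no-three-edges-at {C} {x} {y} {g} {v} (_ , _ , deg≡2) x∈C y∈C g∈C x≢y g≢x g≢y x-end y-end g-end =
    ℕ.n≮n 2 (begin
      3                                                   ≤⟨ +-mono-≤ (+-mono-≤ (IsEnd⇒1≤incidence x-end)
                                                                (IsEnd⇒1≤incidence y-end))
                                                                (IsEnd⇒1≤incidence g-end) ⟩
      incidence G v x + incidence G v y + incidence G v g ≡⟨ cong₂ _+_ (deg-pair x≢y v) (deg-⁅⁆ g v) ⟨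
      deg G (⁅ x ⁆ ∪ ⁅ y ⁆) v + deg G ⁅ g ⁆ v            ≡⟨ deg-∪ pair∩⁅g⁆≡∅ v ⟨
      deg G ((⁅ x ⁆ ∪ ⁅ y ⁆) ∪ ⁅ g ⁆) v                  ≤⟨ deg-mono triple⊆C v ⟩
      deg G C v                                           ≡⟨ deg≡2 v (x , x∈C , x-end) ⟩
      2                                                   ∎)
    where
    open ℕ.≤-Reasoning
    pair∩⁅g⁆≡∅ : EdgeDisjoint G (⁅ x ⁆ ∪ ⁅ y ⁆) ⁅ g ⁆
    pair∩⁅g⁆≡∅ e e∈pair e∈⁅g⁆ with x∈⁅y⁆⇒x≡y g e∈⁅g⁆
    ... | refl = [ g≢x , g≢y ]′ (∈-pair e∈pair)
    triple⊆C : (⁅ x ⁆ ∪ ⁅ y ⁆) ∪ ⁅ g ⁆ ⊆ C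
    triple⊆C e∈triple with ∈-triple e∈triple
    ... | inj₁ refl        = x∈C
    ... | inj₂ (inj₁ refl) = y∈C
    ... | inj₂ (inj₂ refl) = g∈C

  cycle-at-vertex-is-digon : (∀ e → e ∈ C → ¬ IsLoop G e × IsEnd e v) → Cycle G C →
                             ∃[ x ] ∃[ y ] (x ≢ y × C ≡ ⁅ x ⁆ ∪ ⁅ y ⁆)
  cycle-at-vertex-is-digon {C} at-v cycle@((x , x∈C) , _) with at-v x x∈C
  ... | link , x-end with cycle-second-edge cycle x∈C link x-end
  ... | y , y∈C , y≢x , y-end = x , y , y≢x ∘ sym , ⊆-antisym C⊆pair (pair⊆ x∈C y∈C)
    where
    C⊆pair : C ⊆ ⁅ x ⁆ ∪ ⁅ y ⁆
    C⊆pair {g} g∈C with g ≟ x | g ≟ y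
    ... | yes refl | _        = x∈pair
    ... | no _     | yes refl = y∈pair
    ... | no g≢x   | no g≢y   = ⊥-elim (cycle-no-three-edges-at cycle x∈C y∈C g∈C (y≢x ∘ sym) g≢x g≢y
                                                                 x-end y-end (proj₂ (at-v g g∈C)))

  disjoint-cycles-⊄-pair : Cycle G S → (∀ e → e ∈ S → ¬ IsLoop G e) → Nonempty T → EdgeDisjoint G S T →
                           S ⊆ ⁅ x ⁆ ∪ ⁅ y ⁆ → T ⊆ ⁅ x ⁆ ∪ ⁅ y ⁆ → ⊥
  disjoint-cycles-⊄-pair cycle@((e , e∈S) , _) links (z , z∈T) disjoint S⊆pair T⊆pair
    with cycle-second-edge cycle e∈S (links e e∈S) (inj₁ refl)
  ... | f , f∈S , f≢e , _ =
    pigeonhole-pair (∈-pair (S⊆pair e∈S)) (∈-pair (S⊆pair f∈S)) (∈-pair (T⊆pair z∈T))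
      (f≢e ∘ sym) (EdgeDisjoint⇒≢ disjoint e∈S z∈T) (EdgeDisjoint⇒≢ disjoint f∈S z∈T)

  loop-pair-ends : LoopAt G x u → LoopAt G y w → e ∈ ⁅ x ⁆ ∪ ⁅ y ⁆ → IsEnd e v →
                   (e ≡ x × v ≡ u) ⊎ (e ≡ y × v ≡ w)
  loop-pair-ends at₁ at₂ e∈pair end with ∈-pair e∈pair
  ... | inj₁ refl = inj₁ (refl , LoopAt-IsEnd at₁ end)
  ... | inj₂ refl = inj₂ (refl , LoopAt-IsEnd at₂ end)

  loop-pair-loops : LoopAt G x u → LoopAt G y w → e ∈ ⁅ x ⁆ ∪ ⁅ y ⁆ → IsLoop G e
  loop-pair-loops at₁ at₂ e∈pair =
    [ (λ { refl → LoopAt⇒IsLoop at₁ }) , (λ { refl → LoopAt⇒IsLoop at₂ }) ]′ (∈-pair e∈pair)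

  MinDegree≥2 : EdgeSet G → Set
  MinDegree≥2 S = ∀ v → VertexOf G S v → 2 ≤ deg G S v

  cycle⇒MinDegree≥2 : Cycle G C → MinDegree≥2 C
  cycle⇒MinDegree≥2 (_ , _ , deg≡2) v v∈C = ≤-reflexive (sym (deg≡2 v v∈C))

  MinDegree≥2-∪ : MinDegree≥2 S → MinDegree≥2 T → MinDegree≥2 (S ∪ T)
  MinDegree≥2-∪ {S} {T} S≥2 T≥2 v v∈S∪T with VertexOf-∪ v∈S∪T
  ... | inj₁ v∈S = ≤-trans (S≥2 v v∈S) (deg-mono (p⊆p∪q T) v)
  ... | inj₂ v∈T = ≤-trans (T≥2 v v∈T) (deg-mono (q⊆p∪q S T) v)

  path-interior : PathBetween G P u w → VertexOf G P v → v ≢ u → v ≢ w → 2 ≤ deg G P v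
  path-interior (_ , _ , _ , _ , interior) v∈P v≢u v≢w = ≤-reflexive (sym (interior _ v∈P v≢u v≢w))

  two-paths⇒MinDegree≥2 : PathBetween G P u w → PathBetween G S u w → EdgeDisjoint G P S →
                          MinDegree≥2 (P ∪ S)
  two-paths⇒MinDegree≥2 {P} {u} {w} {S} P-path@(_ , _ , Pu≡1 , Pw≡1 , _) S-path@(_ , _ , Su≡1 , Sw≡1 , _)
                        disjoint v v∈P∪S with v ≟ u | v ≟ w
  ... | yes refl | _        = ≤-reflexive (sym (trans (deg-∪ disjoint v) (cong₂ _+_ Pu≡1 Su≡1)))
  ... | no _     | yes refl = ≤-reflexive (sym (trans (deg-∪ disjoint v) (cong₂ _+_ Pw≡1 Sw≡1)))
  ... | no v≢u   | no v≢w with VertexOf-∪ v∈P∪S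
  ...   | inj₁ v∈P = ≤-trans (path-interior P-path v∈P v≢u v≢w) (deg-mono (p⊆p∪q S) v)
  ...   | inj₂ v∈S = ≤-trans (path-interior S-path v∈S v≢u v≢w) (deg-mono (q⊆p∪q P S) v)

  MinDegree≥2-∪-path : MinDegree≥2 S → PathBetween G P u w → VertexOf G S u → VertexOf G S w →
                       MinDegree≥2 (S ∪ P)
  MinDegree≥2-∪-path {S} {P} {u} {w} S≥2 path u∈S w∈S v v∈S∪P with v ≟ u | v ≟ w | VertexOf-∪ v∈S∪P
  ... | _        | _        | inj₁ v∈S = ≤-trans (S≥2 v v∈S) (deg-mono (p⊆p∪q P) v)
  ... | yes refl | _        | inj₂ _   = ≤-trans (S≥2 v u∈S) (deg-mono (p⊆p∪q P) v)
  ... | no _     | yes refl | inj₂ _   = ≤-trans (S≥2 v w∈S) (deg-mono (p⊆p∪q P) v)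
  ... | no v≢u   | no v≢w   | inj₂ v∈P = ≤-trans (path-interior path v∈P v≢u v≢w) (deg-mono (q⊆p∪q S P) v)

  MinDegree≥2-pair⇒Joins : x ≢ y → ¬ IsLoop G x → MinDegree≥2 (⁅ x ⁆ ∪ ⁅ y ⁆) →
                            Joins G y (proj₁ (ends x)) (proj₂ (ends x))
  MinDegree≥2-pair⇒Joins {x} {y} x≢y link pair≥2 =
    IsEnd₂⇒Joins link (end-of-y (inj₁ refl)) (end-of-y (inj₂ refl))
    where
    end-of-y : IsEnd x v → IsEnd y v
    end-of-y {v} x-end = incidence≢0⇒IsEnd λ incidence≡0 → ℕ.n≮n 1 (begin
      2                                 ≤⟨ pair≥2 v (x , x∈pair , x-end) ⟩
      deg G (⁅ x ⁆ ∪ ⁅ y ⁆) v           ≡⟨ deg-pair x≢y v ⟩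
      incidence G v x + incidence G v y ≡⟨ cong₂ _+_ (incidence-link link x-end) incidence≡0 ⟩
      1                                 ∎)
      where open ℕ.≤-Reasoning

-- Circuits and parallel classes of M(G, B, L, F)

module CircuitProperties (G : Graph) (B L F : EdgeSet G → Set) where
  open Graph G
  open GraphProperties G
  open ParallelClasses (Circuit G B L F)

  private
    variable
      S K : EdgeSet G
      k l₁ l₂ x y : Edge G
      p q : Vertex G

  circuit⇒MinDegree≥2 : Circuit G B L F S → MinDegree≥2 S
  circuit⇒MinDegree≥2 (inj₁ (cycle , _)) = cycle⇒MinDegree≥2 cycle
  circuit⇒MinDegree≥2
    (inj₂ (inj₁ ((_ , _ , P₁ , P₂ , _ , path₁ , path₂ , path₃ , _ , _ , _ , d₁₂ , _ , _ , refl) , _))) =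
    MinDegree≥2-∪-path (two-paths⇒MinDegree≥2 path₁ path₂ d₁₂) path₃
      (VertexOf-mono (p⊆p∪q P₂) (path-start path₁)) (VertexOf-mono (p⊆p∪q P₂) (path-end path₁))
  circuit⇒MinDegree≥2 (inj₂ (inj₂ (inj₁ (_ , _ , (cycle₁ , cycle₂ , _) , _ , _ , refl)))) =
    MinDegree≥2-∪ (cycle⇒MinDegree≥2 cycle₁) (cycle⇒MinDegree≥2 cycle₂)
  circuit⇒MinDegree≥2 (inj₂ (inj₂ (inj₂ (inj₁ (_ , _ , cycle₁ , cycle₂ , _ , _ , _ , refl))))) =
    MinDegree≥2-∪ (cycle⇒MinDegree≥2 cycle₁) (cycle⇒MinDegree≥2 cycle₂)
  circuit⇒MinDegree≥2
    (inj₂ (inj₂ (inj₂ (inj₂ (C₁ , C₂ , _ , (cycle₁ , cycle₂ , _ , _ , _ , path , u∈C₁ , w∈C₂ , _) , _ , _ ,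
                              refl))))) =
    MinDegree≥2-∪-path (MinDegree≥2-∪ (cycle⇒MinDegree≥2 cycle₁) (cycle⇒MinDegree≥2 cycle₂)) path
      (VertexOf-mono (p⊆p∪q C₂) u∈C₁) (VertexOf-mono (q⊆p∪q C₁ C₂) w∈C₂)

  -- A theta has three edges, and two edge-disjoint cycles of links have at least three.
  link-pair-circuit⇒balanced : S ⊆ ⁅ x ⁆ ∪ ⁅ y ⁆ → (∀ e → e ∈ S → ¬ IsLoop G e) → Circuit G B L F S → B S
  link-pair-circuit⇒balanced S⊆pair links (inj₁ (_ , balanced)) = balanced
  link-pair-circuit⇒balanced S⊆pair links
    (inj₂ (inj₁ ((_ , _ , P₁ , P₂ , P₃ , path₁ , path₂ , path₃ , _ , _ , _ , d₁₂ , d₁₃ , d₂₃ , refl) , _)))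
    with path-start path₁ | path-start path₂ | path-start path₃
  ... | e₁ , e₁∈P₁ , _ | e₂ , e₂∈P₂ , _ | e₃ , e₃∈P₃ , _ =
    ⊥-elim (pigeonhole-pair (∈-pair (S⊆pair (p⊆p∪q P₃ (p⊆p∪q P₂ e₁∈P₁))))
                            (∈-pair (S⊆pair (p⊆p∪q P₃ (q⊆p∪q P₁ P₂ e₂∈P₂))))
                            (∈-pair (S⊆pair (q⊆p∪q (P₁ ∪ P₂) P₃ e₃∈P₃)))
                            (EdgeDisjoint⇒≢ d₁₂ e₁∈P₁ e₂∈P₂) (EdgeDisjoint⇒≢ d₁₃ e₁∈P₁ e₃∈P₃)
                            (EdgeDisjoint⇒≢ d₂₃ e₂∈P₂ e₃∈P₃))
  link-pair-circuit⇒balanced S⊆pair links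
    (inj₂ (inj₂ (inj₁ (C₁ , C₂ , (cycle₁ , cycle₂ , disjoint , _) , _ , _ , refl)))) =
    ⊥-elim (disjoint-cycles-⊄-pair cycle₁ (λ e → links e ∘ p⊆p∪q C₂) (proj₁ cycle₂) disjoint
              (S⊆pair ∘ p⊆p∪q C₂) (S⊆pair ∘ q⊆p∪q C₁ C₂))
  link-pair-circuit⇒balanced S⊆pair links
    (inj₂ (inj₂ (inj₂ (inj₁ (C₁ , C₂ , cycle₁ , cycle₂ , disjoint , _ , _ , refl))))) =
    ⊥-elim (disjoint-cycles-⊄-pair cycle₁ (λ e → links e ∘ p⊆p∪q C₂) (proj₁ cycle₂)
              (VertexDisjoint⇒EdgeDisjoint disjoint) (S⊆pair ∘ p⊆p∪q C₂) (S⊆pair ∘ q⊆p∪q C₁ C₂))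
  link-pair-circuit⇒balanced S⊆pair links
    (inj₂ (inj₂ (inj₂ (inj₂ (C₁ , C₂ , P , (cycle₁ , cycle₂ , disjoint , _) , _ , _ , refl))))) =
    ⊥-elim (disjoint-cycles-⊄-pair cycle₁ (λ e → links e ∘ C₁⊆S) (proj₁ cycle₂)
              (VertexDisjoint⇒EdgeDisjoint disjoint) (S⊆pair ∘ C₁⊆S) (S⊆pair ∘ p⊆p∪q P ∘ q⊆p∪q C₁ C₂))
    where
    C₁⊆S : C₁ ⊆ (C₁ ∪ C₂) ∪ P
    C₁⊆S = p⊆p∪q P ∘ p⊆p∪q C₂

  -- Of the five kinds of circuit, only a pair of vertex-disjoint cycles of L can consist of
  -- two loops at distinct vertices.
  loop-pair-circuit⇒L : LoopAt G l₁ p → LoopAt G l₂ q → p ≢ q → l₁ ∈ S → l₂ ∈ S → S ⊆ ⁅ l₁ ⁆ ∪ ⁅ l₂ ⁆ →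
                        Circuit G B L F S → L ⁅ l₁ ⁆
  loop-pair-circuit⇒L {l₁} {p} {l₂} {q} at₁ at₂ p≢q l₁∈S l₂∈S S⊆pair (inj₁ ((_ , connected , _) , _)) =
    ⊥-elim (p≢q (Reach-loops (λ e → loop-pair-loops at₁ at₂ ∘ S⊆pair)
                             (connected p q (l₁ , l₁∈S , LoopAt⇒IsEnd at₁) (l₂ , l₂∈S , LoopAt⇒IsEnd at₂))))
  loop-pair-circuit⇒L at₁ at₂ _ _ _ S⊆pair
    (inj₂ (inj₁ ((_ , _ , P₁ , P₂ , P₃ , path₁ , _ , _ , _ , _ , _ , _ , _ , _ , refl) , _))) =
    ⊥-elim (no-path-of-loops (λ e → loop-pair-loops at₁ at₂ ∘ S⊆pair ∘ p⊆p∪q P₃ ∘ p⊆p∪q P₂) path₁)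
  loop-pair-circuit⇒L at₁ at₂ p≢q _ _ S⊆pair
    (inj₂ (inj₂ (inj₁ (C₁ , C₂ , (_ , _ , disjoint , _ , (g₁ , g₁∈C₁ , end₁) , (g₂ , g₂∈C₂ , end₂) , _) ,
                       _ , _ , refl))))
    with loop-pair-ends at₁ at₂ (S⊆pair (p⊆p∪q C₂ g₁∈C₁)) end₁
       | loop-pair-ends at₁ at₂ (S⊆pair (q⊆p∪q C₁ C₂ g₂∈C₂)) end₂
  ... | inj₁ (refl , _)   | inj₁ (refl , _)   = ⊥-elim (disjoint _ g₁∈C₁ g₂∈C₂)
  ... | inj₂ (refl , _)   | inj₂ (refl , _)   = ⊥-elim (disjoint _ g₁∈C₁ g₂∈C₂)
  ... | inj₁ (_ , w≡p)    | inj₂ (_ , w≡q)    = ⊥-elim (p≢q (trans (sym w≡p) w≡q))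
  ... | inj₂ (_ , w≡q)    | inj₁ (_ , w≡p)    = ⊥-elim (p≢q (trans (sym w≡p) w≡q))
  loop-pair-circuit⇒L {l₁} {l₂ = l₂} _ _ _ l₁∈S _ S⊆pair
    (inj₂ (inj₂ (inj₂ (inj₁ (C₁ , C₂ , (C₁≢∅ , _) , (C₂≢∅ , _) , disjoint , L₁ , L₂ , refl))))) =
    [ (λ l₁∈C₁ → subst L (disjoint-parts-of-pair l₁∈C₁ C₂≢∅ C₁∩C₂≡∅ C₁⊆pair C₂⊆pair) L₁)
    , (λ l₁∈C₂ → subst L (disjoint-parts-of-pair l₁∈C₂ C₁≢∅ (flip ∘ C₁∩C₂≡∅) C₂⊆pair C₁⊆pair) L₂)
    ]′ (x∈p∪q⁻ C₁ C₂ l₁∈S)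
    where
    C₁∩C₂≡∅ : EdgeDisjoint G C₁ C₂
    C₁∩C₂≡∅ = VertexDisjoint⇒EdgeDisjoint disjoint
    C₁⊆pair : C₁ ⊆ ⁅ l₁ ⁆ ∪ ⁅ l₂ ⁆
    C₁⊆pair = S⊆pair ∘ p⊆p∪q C₂
    C₂⊆pair : C₂ ⊆ ⁅ l₁ ⁆ ∪ ⁅ l₂ ⁆
    C₂⊆pair = S⊆pair ∘ q⊆p∪q C₁ C₂
  loop-pair-circuit⇒L at₁ at₂ _ _ _ S⊆pair
    (inj₂ (inj₂ (inj₂ (inj₂ (C₁ , C₂ , P , (_ , _ , _ , _ , _ , path , _) , _ , _ , refl))))) =
    ⊥-elim (no-path-of-loops (λ e → loop-pair-loops at₁ at₂ ∘ S⊆pair ∘ q⊆p∪q (C₁ ∪ C₂) P) path)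

  link-class-Joins : ParallelClass (Circuit G B L F) K → k ∈ K → ¬ IsLoop G k →
                     ∀ f → f ∈ K → Joins G f (proj₁ (ends k)) (proj₂ (ends k))
  link-class-Joins {K} {k} K-class k∈K link f f∈K with f ≟ k
  ... | yes refl = inj₁ refl
  ... | no f≢k   = MinDegree≥2-pair⇒Joins (f≢k ∘ sym) link
                     (circuit⇒MinDegree≥2 (ParallelClass-circuit K-class k∈K f∈K (f≢k ∘ sym)))

  loop-class-loops : ParallelClass (Circuit G B L F) K → k ∈ K → IsLoop G k → ∀ f → f ∈ K → IsLoop G f
  loop-class-loops {K} {k} K-class k∈K loop f f∈K with IsLoop? f
  ... | yes f-loop = f-loop
  ... | no link    = ⊥-elim (Joins⇒¬IsLoop link (link-class-Joins K-class f∈K link k k∈K) loop)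

-- Graphs whose edges fall into two parallel classes

module TwoParallelClasses
  (G : Graph) (B L F : EdgeSet G → Set)
  (quasi-biased : QuasiBiased G B L F) (connected : GraphConnected G)
  (loopless : Loopless (Circuit G B L F))
  {K₁ K₂ : EdgeSet G}
  (K₁-class : ParallelClass (Circuit G B L F) K₁) (K₂-class : ParallelClass (Circuit G B L F) K₂)
  (cover : ∀ e → e ∈ K₁ ⊎ e ∈ K₂) (K₁∩K₂≡∅ : ∀ e → e ∈ K₁ → e ∉ K₂)
  where

  open Graph G
  open GraphProperties G
  open ParallelClasses (Circuit G B L F)
  open CircuitProperties G B L F

  private
    variable
      e x y : Edge G
      s p q : Vertex G

  k₁ : Edge G
  k₁ = proj₁ (proj₁ K₁-class)

  k₂ : Edge G
  k₂ = proj₁ (proj₁ K₂-class)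

  k₁∈K₁ : k₁ ∈ K₁
  k₁∈K₁ = proj₂ (proj₁ K₁-class)

  k₂∈K₂ : k₂ ∈ K₂
  k₂∈K₂ = proj₂ (proj₁ K₂-class)

  singleton-unbalanced : ¬ B ⁅ e ⁆
  singleton-unbalanced {e} balanced =
    loopless e (inj₁ (QuasiBiased.B-cycle quasi-biased _ balanced , balanced))

  -- All loops sit at one vertex, so k₁ and k₂ would form a tight handcuff of unbalanced loops.
  loop-classes-impossible : IsLoop G k₁ → IsLoop G k₂ → ⊥
  loop-classes-impossible loop₁ loop₂ =
    K₁∩K₂≡∅ k₂ (ParallelClass-closed K₁-class k₁∈K₁ (inj₂ handcuff-circuit)) k₂∈K₂
    where
    loops : ∀ e → IsLoop G e
    loops e =
      [ loop-class-loops K₁-class k₁∈K₁ loop₁ e , loop-class-loops K₂-class k₂∈K₂ loop₂ e ]′ (cover e)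
    same-vertex : proj₁ (ends k₂) ≡ proj₁ (ends k₁)
    same-vertex = sym (Reach-loops (λ e _ → loops e) (connected _ _))
    k₁≢k₂ : k₁ ≢ k₂
    k₁≢k₂ k₁≡k₂ = K₁∩K₂≡∅ k₁ k₁∈K₁ (subst (_∈ K₂) (sym k₁≡k₂) k₂∈K₂)
    handcuff : TightHandcuff G ⁅ k₁ ⁆ ⁅ k₂ ⁆
    handcuff = loop-cycle loop₁ , loop-cycle loop₂ , ⁅⁆-disjoint k₁≢k₂ , proj₁ (ends k₁) ,
               (k₁ , x∈⁅x⁆ k₁ , inj₁ refl) , (k₂ , x∈⁅x⁆ k₂ , inj₁ same-vertex) ,
               λ v v∈⁅k₁⁆ _ → IsEnd-loop loop₁ (VertexOf-⁅⁆ v∈⁅k₁⁆)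
    handcuff-circuit : Circuit G B L F (⁅ k₁ ⁆ ∪ ⁅ k₂ ⁆)
    handcuff-circuit =
      inj₂ (inj₂ (inj₁ (⁅ k₁ ⁆ , ⁅ k₂ ⁆ , handcuff , singleton-unbalanced , singleton-unbalanced , refl)))

  module _ (k₁-loop : IsLoop G k₁) (k₂-link : ¬ IsLoop G k₂) where

    private
      u w : Vertex G
      u = proj₁ (ends k₂)
      w = proj₂ (ends k₂)

      K₁-loops : e ∈ K₁ → IsLoop G e
      K₁-loops = loop-class-loops K₁-class k₁∈K₁ k₁-loop _

      K₂-Joins : e ∈ K₂ → Joins G e u w
      K₂-Joins = link-class-Joins K₂-class k₂∈K₂ k₂-link _

      K₁⇔IsLoop : ∀ e → e ∈ K₁ ⇔ IsLoop G e
      K₁⇔IsLoop e = mk⇔ K₁-loops λ loop →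
        [ id , (λ e∈K₂ → ⊥-elim (Joins⇒¬IsLoop k₂-link (K₂-Joins e∈K₂) loop)) ]′ (cover e)

      K₂⇔¬IsLoop : ∀ e → e ∈ K₂ ⇔ (¬ IsLoop G e)
      K₂⇔¬IsLoop e = mk⇔ (Joins⇒¬IsLoop k₂-link ∘ K₂-Joins) λ link →
        [ ⊥-elim ∘ link ∘ K₁-loops , id ]′ (cover e)

      K₂⇔Joins : ∀ e → e ∈ K₂ ⇔ Joins G e u w
      K₂⇔Joins e = mk⇔ K₂-Joins (Equivalence.from (K₂⇔¬IsLoop e) ∘ Joins⇒¬IsLoop k₂-link)

      every-vertex-on-k₂ : ∀ v → v ≡ u ⊎ v ≡ w
      every-vertex-on-k₂ = connected-invariant connected _ closed (inj₁ refl)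
        where
        closed : ∀ e x y → Joins G e x y → x ≡ u ⊎ x ≡ w → y ≡ u ⊎ y ≡ w
        closed e x y j x∈uw =
          [ (λ e∈K₁ → subst (λ v → v ≡ u ⊎ v ≡ w) (Joins-loop (K₁-loops e∈K₁) j) x∈uw)
          , (λ e∈K₂ → IsEnd-Joins (K₂-Joins e∈K₂) (Joins⇒IsEnd₂ j))
          ]′ (cover e)

      loops-at-one-vertex : (∀ e → e ∈ K₁ → proj₁ (ends e) ≡ proj₁ (ends k₁)) → Outcome-iii G B L F K₁ K₂
      loops-at-one-vertex at-k₁ =
        exactly-two k₂-link every-vertex-on-k₂ ,
        (proj₁ (ends k₁) , λ e e∈K₁ → subst (LoopAt G e) (at-k₁ e e∈K₁) (IsLoop⇒LoopAt (K₁-loops e∈K₁)) ,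
                                      singleton-unbalanced) ,
        (u , w , k₂-link , K₂⇔Joins)

      loops-at-two-vertices : ∀ {l} → l ∈ K₁ → proj₁ (ends l) ≢ proj₁ (ends k₁) →
                              Outcome-iv G B L F K₁ K₂
      loops-at-two-vertices {l} l∈K₁ q≢p =
        exactly-two k₂-link every-vertex-on-k₂ , loop-everywhere , loops-in-L , K₁⇔IsLoop , K₂⇔¬IsLoop
        where
        at-p : LoopAt G k₁ (proj₁ (ends k₁))
        at-p = IsLoop⇒LoopAt k₁-loop
        at-q : LoopAt G l (proj₁ (ends l))
        at-q = IsLoop⇒LoopAt (K₁-loops l∈K₁)
        p-or-q : ∀ v → v ≡ proj₁ (ends k₁) ⊎ v ≡ proj₁ (ends l)
        p-or-q v with v ≟ proj₁ (ends k₁) | v ≟ proj₁ (ends l)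
        ... | yes v≡p | _       = inj₁ v≡p
        ... | no _    | yes v≡q = inj₂ v≡q
        ... | no v≢p  | no v≢q  =
          ⊥-elim (pigeonhole-pair (every-vertex-on-k₂ v) (every-vertex-on-k₂ _) (every-vertex-on-k₂ _)
                                  v≢p v≢q (q≢p ∘ sym))
        loop-everywhere : ∀ v → ∃[ e ] LoopAt G e v
        loop-everywhere v = [ (λ { refl → k₁ , at-p }) , (λ { refl → l , at-q }) ]′ (p-or-q v)
        -- A loop e is parallel to the loop among k₁, l at the other vertex.
        loops-in-L : ∀ e → IsLoop G e → L ⁅ e ⁆
        loops-in-L e loop with p-or-q (proj₁ (ends e))
        ... | inj₁ e-at-p = loop-pair-circuit⇒L (subst (LoopAt G e) e-at-p (IsLoop⇒LoopAt loop)) at-q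
                              (q≢p ∘ sym) x∈pair y∈pair id
                              (ParallelClass-circuit K₁-class (Equivalence.from (K₁⇔IsLoop e) loop) l∈K₁
                                                     λ { refl → q≢p e-at-p })
        ... | inj₂ e-at-q = loop-pair-circuit⇒L (subst (LoopAt G e) e-at-q (IsLoop⇒LoopAt loop)) at-p
                              q≢p x∈pair y∈pair id
                              (ParallelClass-circuit K₁-class (Equivalence.from (K₁⇔IsLoop e) loop) k₁∈K₁
                                                     λ { refl → q≢p (sym e-at-q) })

    loop-and-link-classes : Outcome-iii G B L F K₁ K₂ ⊎ Outcome-iv G B L F K₁ K₂
    loop-and-link-classes with any? (λ e → (e ∈? K₁) ×-dec ¬? (proj₁ (ends e) ≟ proj₁ (ends k₁)))
    ... | yes (l , l∈K₁ , q≢p) = inj₂ (loops-at-two-vertices l∈K₁ q≢p)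
    ... | no none              =
      inj₁ (loops-at-one-vertex λ e e∈K₁ → decidable-stable (_ ≟ _) λ q≢p → none (e , e∈K₁ , q≢p))

  balanced-digon⇔same-class : x ≢ y → ¬ IsLoop G x → ¬ IsLoop G y →
                              B (⁅ x ⁆ ∪ ⁅ y ⁆) ⇔ (⁅ x ⁆ ∪ ⁅ y ⁆ ⊆ K₁ ⊎ ⁅ x ⁆ ∪ ⁅ y ⁆ ⊆ K₂)
  balanced-digon⇔same-class {x} {y} x≢y x-link y-link = mk⇔ to from
    where
    links : ∀ e → e ∈ ⁅ x ⁆ ∪ ⁅ y ⁆ → ¬ IsLoop G e
    links e e∈pair = [ (λ { refl → x-link }) , (λ { refl → y-link }) ]′ (∈-pair e∈pair)
    to : B (⁅ x ⁆ ∪ ⁅ y ⁆) → ⁅ x ⁆ ∪ ⁅ y ⁆ ⊆ K₁ ⊎ ⁅ x ⁆ ∪ ⁅ y ⁆ ⊆ K₂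
    to balanced = Sum.map (pair-in K₁-class) (pair-in K₂-class) (cover x)
      where
      x∥y : Parallel (Circuit G B L F) x y
      x∥y = inj₂ (inj₁ (QuasiBiased.B-cycle quasi-biased _ balanced , balanced))
      pair-in : ∀ {K} → ParallelClass (Circuit G B L F) K → x ∈ K → ⁅ x ⁆ ∪ ⁅ y ⁆ ⊆ K
      pair-in K-class x∈K = pair⊆ x∈K (ParallelClass-closed K-class x∈K x∥y)
    from : ⁅ x ⁆ ∪ ⁅ y ⁆ ⊆ K₁ ⊎ ⁅ x ⁆ ∪ ⁅ y ⁆ ⊆ K₂ → B (⁅ x ⁆ ∪ ⁅ y ⁆)
    from = [ balanced-in K₁-class , balanced-in K₂-class ]′
      where
      balanced-in : ∀ {K} → ParallelClass (Circuit G B L F) K → ⁅ x ⁆ ∪ ⁅ y ⁆ ⊆ K → B (⁅ x ⁆ ∪ ⁅ y ⁆)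
      balanced-in K-class pair⊆K = link-pair-circuit⇒balanced id links
                                     (ParallelClass-circuit K-class (pair⊆K x∈pair) (pair⊆K y∈pair) x≢y)

  shared-end : ∀ {a b c d} → a ≢ b → c ≢ d →
               (∀ e → e ∈ K₁ → Joins G e a b) → (∀ e → e ∈ K₂ → Joins G e c d) →
               ∃[ s ] ∃[ p ] ∃[ q ] (s ≢ p × s ≢ q ×
                                     (∀ e → e ∈ K₁ → Joins G e s p) × (∀ e → e ∈ K₂ → Joins G e s q))
  shared-end {a} {b} {c} {d} a≢b c≢d K₁-ab K₂-cd with c ≟ a | c ≟ b | d ≟ a | d ≟ b
  ... | yes refl | _        | _        | _        = a , b , d , a≢b , c≢d , K₁-ab , K₂-cd
  ... | _        | yes refl | _        | _        =
    b , a , d , a≢b ∘ sym , c≢d , (λ e → Joins-sym ∘ K₁-ab e) , K₂-cd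
  ... | _        | _        | yes refl | _        =
    a , b , c , a≢b , c≢d ∘ sym , K₁-ab , (λ e → Joins-sym ∘ K₂-cd e)
  ... | _        | _        | _        | yes refl =
    b , a , c , a≢b ∘ sym , c≢d ∘ sym , (λ e → Joins-sym ∘ K₁-ab e) , (λ e → Joins-sym ∘ K₂-cd e)
  ... | no c≢a   | no c≢b   | no d≢a   | no d≢b   =
    ⊥-elim ([ c≢a , c≢b ]′ (connected-invariant connected (λ v → v ≡ a ⊎ v ≡ b) closed (inj₁ refl) c))
    where
    closed : ∀ e x y → Joins G e x y → x ≡ a ⊎ x ≡ b → y ≡ a ⊎ y ≡ b
    closed e x y j x∈ab with cover e
    ... | inj₁ e∈K₁ = IsEnd-Joins (K₁-ab e e∈K₁) (Joins⇒IsEnd₂ j)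
    ... | inj₂ e∈K₂ with IsEnd-Joins (K₂-cd e e∈K₂) (Joins⇒IsEnd₁ j) | x∈ab
    ...   | inj₁ refl | inj₁ refl = ⊥-elim (c≢a refl)
    ...   | inj₁ refl | inj₂ refl = ⊥-elim (c≢b refl)
    ...   | inj₂ refl | inj₁ refl = ⊥-elim (d≢a refl)
    ...   | inj₂ refl | inj₂ refl = ⊥-elim (d≢b refl)

  parallel-links : s ≢ p → (∀ e → Joins G e s p) → Outcome-ii G B L F K₁ K₂
  parallel-links {s} {p} s≢p all-sp = exactly-two s≢p two-vertices , link , cycles
    where
    link : ∀ e → ¬ IsLoop G e
    link e = Joins⇒¬IsLoop s≢p (all-sp e)
    two-vertices : ∀ v → v ≡ s ⊎ v ≡ p
    two-vertices =
      connected-invariant connected _ (λ e x y j _ → IsEnd-Joins (all-sp e) (Joins⇒IsEnd₂ j)) (inj₁ refl)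
    cycles : ∀ C → Cycle G C → B C ⇔ (C ⊆ K₁ ⊎ C ⊆ K₂)
    cycles C cycle with cycle-at-vertex-is-digon (λ e _ → link e , Joins⇒IsEnd₁ (all-sp e)) cycle
    ... | x , y , x≢y , refl = balanced-digon⇔same-class x≢y (link x) (link y)

  star-links : s ≢ p → s ≢ q → p ≢ q → (∀ e → e ∈ K₁ → Joins G e s p) → (∀ e → e ∈ K₂ → Joins G e s q) →
               Outcome-i G B L F K₁ K₂
  star-links {s} {p} {q} s≢p s≢q p≢q K₁-sp K₂-sq =
    exactly-three s≢p s≢q p≢q three-vertices , link , all-balanced ,
    (s , p , s , q , s≢p , s≢q , [ p≢q ∘ proj₂ , s≢q ∘ proj₁ ]′ , K₁⇔Joins , K₂⇔Joins)
    where
    link : ∀ e → ¬ IsLoop G e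
    link e = [ Joins⇒¬IsLoop s≢p ∘ K₁-sp e , Joins⇒¬IsLoop s≢q ∘ K₂-sq e ]′ (cover e)
    at-s : ∀ e → IsEnd e s
    at-s e = [ Joins⇒IsEnd₁ ∘ K₁-sp e , Joins⇒IsEnd₁ ∘ K₂-sq e ]′ (cover e)
    three-vertices : ∀ v → v ≡ s ⊎ v ≡ p ⊎ v ≡ q
    three-vertices = connected-invariant connected _ closed (inj₁ refl)
      where
      closed : ∀ e x y → Joins G e x y → x ≡ s ⊎ x ≡ p ⊎ x ≡ q → y ≡ s ⊎ y ≡ p ⊎ y ≡ q
      closed e x y j _ = [ (λ e∈K₁ → Sum.map₂ inj₁ (IsEnd-Joins (K₁-sp e e∈K₁) (Joins⇒IsEnd₂ j)))
                         , (λ e∈K₂ → Sum.map₂ inj₂ (IsEnd-Joins (K₂-sq e e∈K₂) (Joins⇒IsEnd₂ j))) ]′ (cover e)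
    K₁⇔Joins : ∀ e → e ∈ K₁ ⇔ Joins G e s p
    K₁⇔Joins e = mk⇔ (K₁-sp e) λ j →
      [ id , (λ e∈K₂ → ⊥-elim ([ s≢p ∘ sym , p≢q ]′ (IsEnd-Joins (K₂-sq e e∈K₂) (Joins⇒IsEnd₂ j)))) ]′
        (cover e)
    K₂⇔Joins : ∀ e → e ∈ K₂ ⇔ Joins G e s q
    K₂⇔Joins e = mk⇔ (K₂-sq e) λ j →
      [ (λ e∈K₁ → ⊥-elim ([ s≢q ∘ sym , p≢q ∘ sym ]′ (IsEnd-Joins (K₁-sp e e∈K₁) (Joins⇒IsEnd₂ j)))) , id ]′
        (cover e)
    -- A cycle is a digon {x, y} in which y joins the ends of x, so x and y lie in one class.
    all-balanced : ∀ C → Cycle G C → B C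
    all-balanced C cycle with cycle-at-vertex-is-digon (λ e _ → link e , at-s e) cycle
    ... | x , y , x≢y , refl = Equivalence.from (balanced-digon⇔same-class x≢y (link x) (link y)) same-class
      where
      y∥x : Joins G y (proj₁ (ends x)) (proj₂ (ends x))
      y∥x = MinDegree≥2-pair⇒Joins x≢y (link x) (cycle⇒MinDegree≥2 cycle)
      same-class : ⁅ x ⁆ ∪ ⁅ y ⁆ ⊆ K₁ ⊎ ⁅ x ⁆ ∪ ⁅ y ⁆ ⊆ K₂
      same-class =
        Sum.map (λ x∈K₁ → pair⊆ x∈K₁ (Equivalence.from (K₁⇔Joins y) (Joins-resp-ends (K₁-sp x x∈K₁) y∥x)))
                (λ x∈K₂ → pair⊆ x∈K₂ (Equivalence.from (K₂⇔Joins y) (Joins-resp-ends (K₂-sq x x∈K₂) y∥x)))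
                (cover x)

  link-classes : ¬ IsLoop G k₁ → ¬ IsLoop G k₂ → Outcome-i G B L F K₁ K₂ ⊎ Outcome-ii G B L F K₁ K₂
  link-classes k₁-link k₂-link
    with shared-end k₁-link k₂-link (link-class-Joins K₁-class k₁∈K₁ k₁-link)
                                    (link-class-Joins K₂-class k₂∈K₂ k₂-link)
  ... | s , p , q , s≢p , s≢q , K₁-sp , K₂-sq with p ≟ q
  ... | yes refl = inj₂ (parallel-links s≢p λ e → [ K₁-sp e , K₂-sq e ]′ (cover e))
  ... | no p≢q   = inj₁ (star-links s≢p s≢q p≢q K₁-sp K₂-sq)

Outcomes : (G : Graph) (B L F : EdgeSet G → Set) → EdgeSet G → EdgeSet G → Set
Outcomes G B L F X Y = Outcome-i G B L F X Y ⊎ Outcome-ii G B L F X Y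
  ⊎ (Outcome-iii G B L F X Y ⊎ Outcome-iii G B L F Y X)
  ⊎ (Outcome-iv G B L F X Y ⊎ Outcome-iv G B L F Y X)

lemma6p2 : (G : Graph) (B L F : EdgeSet G → Set)
    → QuasiBiased G B L F
    → GraphConnected G
    → ¬ MConnected (Circuit G B L F)
    → Loopless (Circuit G B L F)
    → HasRank (Circuit G B L F) 2
    → (X Y : EdgeSet G)
    → ParallelClass (Circuit G B L F) X
    → ParallelClass (Circuit G B L F) Y
    → X ≢ Y
    → Outcome-i G B L F X Y ⊎ Outcome-ii G B L F X Y
      ⊎ (Outcome-iii G B L F X Y ⊎ Outcome-iii G B L F Y X)
      ⊎ (Outcome-iv G B L F X Y ⊎ Outcome-iv G B L F Y X)
lemma6p2 G B L F quasi-biased connected ¬M-connected loopless rank X Y X-class Y-class X≢Y =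
  classify (IsLoop? XY.k₁) (IsLoop? XY.k₂)
  where
  open GraphProperties G using (IsLoop?)
  open ParallelClasses (Circuit G B L F)
  cover : ∀ e → e ∈ X ⊎ e ∈ Y
  cover = ParallelClasses-cover loopless rank ¬M-connected X-class Y-class X≢Y
  X∩Y≡∅ : ∀ e → e ∈ X → e ∉ Y
  X∩Y≡∅ _ = ParallelClasses-disjoint X-class Y-class X≢Y
  module XY = TwoParallelClasses G B L F quasi-biased connected loopless X-class Y-class cover X∩Y≡∅
  module YX = TwoParallelClasses G B L F quasi-biased connected loopless Y-class X-class
                (Sum.swap ∘ cover) (flip ∘ X∩Y≡∅)
  classify : Dec (IsLoop G XY.k₁) → Dec (IsLoop G XY.k₂) → Outcomes G B L F X Y
  classify (yes loop₁) (yes loop₂) = ⊥-elim (XY.loop-classes-impossible loop₁ loop₂)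
  classify (yes loop₁) (no link₂)  = inj₂ (inj₂ (Sum.map inj₁ inj₁ (XY.loop-and-link-classes loop₁ link₂)))
  classify (no link₁)  (yes loop₂) = inj₂ (inj₂ (Sum.map inj₂ inj₂ (YX.loop-and-link-classes loop₂ link₁)))
  classify (no link₁)  (no link₂)  = Sum.map₂ inj₁ (XY.link-classes link₁ link₂)
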